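{- Let $0<q<1$, $n,m\in\mathbb{N}_0$, and let $x,y$ be complex numbers with $y\neq0$ (and such that no denominator vanishes). Then $${}_2\Phi_1\left[\begin{matrix}q^{ -n},x\\ y\end{matrix};q;q^{1+m}\right]=\frac{x^n\left(\frac yx;q\right)_n}{(y;q)_n}\sum_{j=0}^m\begin{bmatrix}m\\ j\end{bmatrix}_q\frac{\left(\frac{q^{1-n}}{y},\frac{qx}{y};q\right)_{m-j}}{\left(\frac{xq^{1-n}}{y};q\right)_{m-j}}\left(\frac qy\right)^j.$$
   Context: Throughout $0<q<1$. For complex $a$: $(a;q)_0=1$, $(a;q)_n=\prod_{k=0}^{n-1}(1-aq^k)$, and $(a_1,\dots,a_r;q)_n=(a_1;q)_n\cdots(a_r;q)_n$. The $q$-binomial coefficient is $\begin{bmatrix}m\\ j\end{bmatrix}_q=\frac{(q;q)_m}{(q;q)_j(q;q)_{m-j}}$. Here $${}_2\Phi_1\left[\begin{matrix}a,b\\ c\end{matrix};q;z\right]=\sum_{k=0}^\infty\frac{(a,b;q)_k}{(c,q;q)_k}z^k,$$ which terminates when $a=q^{ -n}$. -}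

module Defs where

open import Level using (Level; _⊔_) renaming (suc to lsuc)
open import Data.Nat using (ℕ; suc; _∸_) renaming (zero to ℕzero)
open import Algebra.Bundles using (CommutativeRing)
open import Relation.Nullary using (¬_)

record Field (c ℓ : Level) : Set (lsuc (c ⊔ ℓ)) where
  field
    commutativeRing : CommutativeRing c ℓ
  open CommutativeRing commutativeRing public
  field
    _⁻¹      : Carrier → Carrier
    ⁻¹-cong  : ∀ {a b} → a ≈ b → a ⁻¹ ≈ b ⁻¹
    inverseʳ : ∀ a → ¬ (a ≈ 0#) → (a * (a ⁻¹)) ≈ 1#
    1≉0      : ¬ (1# ≈ 0#)

module FieldOps {c ℓ} (F : Field c ℓ) where
  open Field F public

  infixl 7 _/_
  _/_ : Carrier → Carrier → Carrier
  a / b = a * (b ⁻¹)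

  pow : Carrier → ℕ → Carrier
  pow a ℕzero    = 1#
  pow a (suc k) = a * pow a k

  qPoch : Carrier → Carrier → ℕ → Carrier
  qPoch a q ℕzero    = 1#
  qPoch a q (suc k) = qPoch a q k * (1# - a * pow q k)

  qBinom : Carrier → ℕ → ℕ → Carrier
  qBinom q m j = qPoch q q m / (qPoch q q j * qPoch q q (m ∸ j))

  sumTo : ℕ → (ℕ → Carrier) → Carrier
  sumTo ℕzero    f = f ℕzero
  sumTo (suc n) f = sumTo n f + f (suc n)

  -- terminating 2Φ1[q^{-n}, b; c; q; z] = Σ_{k=0}^{n} (q^{-n},b;q)_k/(c,q;q)_k z^k
  -- (terms with k > n vanish since (q^{-n};q)_k = 0 there)
  phi21term : ℕ → Carrier → Carrier → Carrier → Carrier → Carrier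
  phi21term n b c' q z =
    sumTo n (λ k → (qPoch (pow (q ⁻¹) n) q k * qPoch b q k)
                   / (qPoch c' q k * qPoch q q k) * pow z k)

-- Multiplying by (y;q)ₙ turns the left-hand side into a polynomial Ψ in z that obeys two
-- contiguous relations: one lowering n, which by induction on n gives the q-Chu–Vandermonde sum
-- Ψ(q) = xⁿ (y/x;q)ₙ, and one trading z ↦ qz for y ↦ y/q.  Read as a function of m and y, the
-- right-hand side satisfies the second relation as a recursion in m, by q-Pascal for the Gaussian
-- binomials; the two sides agree at m = 0 by q-Chu–Vandermonde, so induction on m finishes.
module Submission where

open import Defs
open import Data.Nat using (ℕ; suc; _≤_; _∸_)
open import Relation.Nullary using (¬_)

open import Algebra.Bundles using (CommutativeRing)
import Algebra.Solver.Ring.AlmostCommutativeRing as ACR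
open import Data.Integer as ℤ using (ℤ; 0ℤ; 1ℤ; +_; -[1+_]; _⊖_; _◃_; sign; ∣_∣)
import Data.Integer.Properties as ℤ
open import Data.Maybe using (Maybe; map)
open import Data.Nat as ℕ using (zero; _<_; z≤n; s≤s)
import Data.Nat.Properties as ℕₚ
open import Data.Sign as Sign using (Sign)
open import Data.Sum using (inj₁; inj₂)
open import Function using (id)
open import Relation.Binary.Consequences using (dec⇒weaklyDec)
open import Relation.Binary.PropositionalEquality as ≡ using (_≡_)

-- Algebra.Solver.Ring over any commutative ring with ℤ coefficients (the library's
-- natural-coefficient instance cannot express subtraction).
module IntegerCoefficientSolver {c ℓ} (R : CommutativeRing c ℓ) where
  open CommutativeRing R
  open import Algebra.Properties.Ring ring
    using (-0#≈0#; -‿involutive; -‿distribˡ-*; -‿distribʳ-*; -‿+-comm; -‿anti-homo-+)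
  open import Algebra.Properties.Semiring.Mult.TCOptimised semiring
    using (_×_; ×-homo-+; ×1-homo-*; 1+×)
  open import Relation.Binary.Reasoning.Setoid setoid

  ⟦_⟧ℤ : ℤ → Carrier
  ⟦ + n ⟧ℤ      = n × 1#
  ⟦ -[1+ n ] ⟧ℤ = - (suc n × 1#)

  signed : Sign → Carrier → Carrier
  signed Sign.+ a = a
  signed Sign.- a = - a

  ⟦◃⟧ : ∀ s n → ⟦ s ◃ n ⟧ℤ ≈ signed s (n × 1#)
  ⟦◃⟧ Sign.+ zero    = refl
  ⟦◃⟧ Sign.- zero    = sym -0#≈0#
  ⟦◃⟧ Sign.+ (suc n) = refl
  ⟦◃⟧ Sign.- (suc n) = refl

  ⟦⟧-signAbs : ∀ i → ⟦ i ⟧ℤ ≈ signed (sign i) (∣ i ∣ × 1#)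
  ⟦⟧-signAbs i = trans (reflexive (≡.cong ⟦_⟧ℤ (≡.sym (ℤ.◃-inverse i)))) (⟦◃⟧ (sign i) ∣ i ∣)

  signed-* : ∀ s t a b → signed (s Sign.* t) (a * b) ≈ signed s a * signed t b
  signed-* Sign.+ Sign.+ a b = refl
  signed-* Sign.+ Sign.- a b = -‿distribʳ-* a b
  signed-* Sign.- Sign.+ a b = -‿distribˡ-* a b
  signed-* Sign.- Sign.- a b = begin
    a * b         ≈⟨ -‿involutive (a * b) ⟨
    - - (a * b)   ≈⟨ -‿cong (-‿distribʳ-* a b) ⟩
    - (a * - b)   ≈⟨ -‿distribˡ-* a (- b) ⟩
    - a * - b     ∎

  signed-cong : ∀ s {a b} → a ≈ b → signed s a ≈ signed s b
  signed-cong Sign.+ = id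
  signed-cong Sign.- = -‿cong

  *-homo : ∀ i j → ⟦ i ℤ.* j ⟧ℤ ≈ ⟦ i ⟧ℤ * ⟦ j ⟧ℤ
  *-homo i j = begin
    ⟦ sign i Sign.* sign j ◃ ∣ i ∣ ℕ.* ∣ j ∣ ⟧ℤ
      ≈⟨ ⟦◃⟧ (sign i Sign.* sign j) (∣ i ∣ ℕ.* ∣ j ∣) ⟩
    signed (sign i Sign.* sign j) ((∣ i ∣ ℕ.* ∣ j ∣) × 1#)
      ≈⟨ signed-cong (sign i Sign.* sign j) (×1-homo-* ∣ i ∣ ∣ j ∣) ⟩
    signed (sign i Sign.* sign j) ((∣ i ∣ × 1#) * (∣ j ∣ × 1#))
      ≈⟨ signed-* (sign i) (sign j) _ _ ⟩
    signed (sign i) (∣ i ∣ × 1#) * signed (sign j) (∣ j ∣ × 1#)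
      ≈⟨ *-cong (⟦⟧-signAbs i) (⟦⟧-signAbs j) ⟨
    ⟦ i ⟧ℤ * ⟦ j ⟧ℤ ∎

  ⊖-homo : ∀ m n → ⟦ m ⊖ n ⟧ℤ ≈ m × 1# - n × 1#
  ⊖-homo zero    zero    = sym (trans (+-congˡ -0#≈0#) (+-identityʳ 0#))
  ⊖-homo (suc m) zero    = sym (trans (+-congˡ -0#≈0#) (+-identityʳ _))
  ⊖-homo zero    (suc n) = sym (+-identityˡ _)
  ⊖-homo (suc m) (suc n) = begin
    ⟦ suc m ⊖ suc n ⟧ℤ                      ≡⟨ ≡.cong ⟦_⟧ℤ (ℤ.[1+m]⊖[1+n]≡m⊖n m n) ⟩
    ⟦ m ⊖ n ⟧ℤ                              ≈⟨ ⊖-homo m n ⟩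
    M - N                                  ≈⟨ +-congʳ (+-identityˡ M) ⟨
    (0# + M) - N                           ≈⟨ +-congʳ (+-congʳ (-‿inverseʳ 1#)) ⟨
    ((1# - 1#) + M) - N                    ≈⟨ +-congʳ (+-assoc 1# (- 1#) M) ⟩
    (1# + (- 1# + M)) - N                  ≈⟨ +-congʳ (+-congˡ (+-comm (- 1#) M)) ⟩
    (1# + (M - 1#)) - N                    ≈⟨ +-congʳ (+-assoc 1# M (- 1#)) ⟨
    ((1# + M) - 1#) - N                    ≈⟨ +-assoc (1# + M) (- 1#) (- N) ⟩
    (1# + M) + (- 1# + - N)                ≈⟨ +-cong (1+× m 1#) (-‿anti-homo-+ N 1#) ⟨
    suc m × 1# + - (N + 1#)                ≈⟨ +-congˡ (-‿cong (trans (1+× n 1#) (+-comm 1# N))) ⟨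
    suc m × 1# - suc n × 1#                ∎
    where
    M = m × 1#
    N = n × 1#

  +-homo : ∀ i j → ⟦ i ℤ.+ j ⟧ℤ ≈ ⟦ i ⟧ℤ + ⟦ j ⟧ℤ
  +-homo (+ m)      (+ n)      = ×-homo-+ 1# m n
  +-homo (+ m)      -[1+ n ]   = ⊖-homo m (suc n)
  +-homo -[1+ m ]   (+ n)      = trans (⊖-homo n (suc m)) (+-comm _ _)
  +-homo -[1+ m ]   -[1+ n ]   = begin
    - (suc (suc (m ℕ.+ n)) × 1#)           ≈⟨ -‿cong (1+× (suc (m ℕ.+ n)) 1#) ⟩
    - (1# + suc (m ℕ.+ n) × 1#)            ≡⟨ ≡.cong (λ k → - (1# + k × 1#)) (ℕₚ.+-suc m n) ⟨
    - (1# + (m ℕ.+ suc n) × 1#)            ≈⟨ -‿cong (+-congˡ (×-homo-+ 1# m (suc n))) ⟩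
    - (1# + (m × 1# + suc n × 1#))         ≈⟨ -‿cong (+-assoc 1# _ _) ⟨
    - ((1# + m × 1#) + suc n × 1#)         ≈⟨ -‿cong (+-congʳ (1+× m 1#)) ⟨
    - (suc m × 1# + suc n × 1#)            ≈⟨ -‿+-comm _ _ ⟨
    - (suc m × 1#) + - (suc n × 1#)        ∎

  -‿homo : ∀ i → ⟦ ℤ.- i ⟧ℤ ≈ - ⟦ i ⟧ℤ
  -‿homo -[1+ n ]  = sym (-‿involutive _)
  -‿homo (+ zero)  = sym -0#≈0#
  -‿homo (+ suc n) = refl

  ⟦⟧ℤ-≟ : ∀ i j → Maybe (⟦ i ⟧ℤ ≈ ⟦ j ⟧ℤ)
  ⟦⟧ℤ-≟ i j = map (λ i≡j → reflexive (≡.cong ⟦_⟧ℤ i≡j)) (dec⇒weaklyDec ℤ._≟_ i j)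

  morphism : ℤ.+-*-rawRing ACR.-Raw-AlmostCommutative⟶ ACR.fromCommutativeRing R
  morphism = record
    { ⟦_⟧ = ⟦_⟧ℤ ; +-homo = +-homo ; *-homo = *-homo ; -‿homo = -‿homo
    ; 0-homo = refl ; 1-homo = refl }

  open import Algebra.Solver.Ring ℤ.+-*-rawRing (ACR.fromCommutativeRing R) morphism ⟦⟧ℤ-≟
    public using (solve; _:=_; _:+_; _:*_; _:-_; :-_; con)

module FieldProperties {c ℓ} (F : Field c ℓ) where
  open FieldOps F
  open IntegerCoefficientSolver commutativeRing
  open import Relation.Binary.Reasoning.Setoid setoid

  inverseˡ : ∀ a → a ≉ 0# → a ⁻¹ * a ≈ 1#
  inverseˡ a a≉0 = trans (*-comm _ _) (inverseʳ a a≉0)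

  ≉0-resp-≈ : ∀ {a b} → a ≈ b → a ≉ 0# → b ≉ 0#
  ≉0-resp-≈ a≈b a≉0 b≈0 = a≉0 (trans a≈b b≈0)

  *-≉0 : ∀ {a b} → a ≉ 0# → b ≉ 0# → a * b ≉ 0#
  *-≉0 {a} {b} a≉0 b≉0 ab≈0 = b≉0 (begin
    b                ≈⟨ *-identityˡ b ⟨
    1# * b           ≈⟨ *-congʳ (inverseˡ a a≉0) ⟨
    (a ⁻¹ * a) * b   ≈⟨ *-assoc _ _ _ ⟩
    a ⁻¹ * (a * b)   ≈⟨ *-congˡ ab≈0 ⟩
    a ⁻¹ * 0#        ≈⟨ zeroʳ _ ⟩
    0#               ∎)

  *-≉0⇒≉0ˡ : ∀ {a b} → a * b ≉ 0# → a ≉ 0#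
  *-≉0⇒≉0ˡ {b = b} ab≉0 a≈0 = ab≉0 (trans (*-congʳ a≈0) (zeroˡ b))

  *-≉0⇒≉0ʳ : ∀ {a b} → a * b ≉ 0# → b ≉ 0#
  *-≉0⇒≉0ʳ {a} ab≉0 b≈0 = ab≉0 (trans (*-congˡ b≈0) (zeroʳ a))

  ⁻¹-unique : ∀ {a b} → a ≉ 0# → a * b ≈ 1# → a ⁻¹ ≈ b
  ⁻¹-unique {a} {b} a≉0 ab≈1 = begin
    a ⁻¹             ≈⟨ *-identityʳ _ ⟨
    a ⁻¹ * 1#        ≈⟨ *-congˡ ab≈1 ⟨
    a ⁻¹ * (a * b)   ≈⟨ *-assoc _ _ _ ⟨
    (a ⁻¹ * a) * b   ≈⟨ *-congʳ (inverseˡ a a≉0) ⟩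
    1# * b           ≈⟨ *-identityˡ b ⟩
    b                ∎

  ⁻¹-≉0 : ∀ {a} → a ≉ 0# → a ⁻¹ ≉ 0#
  ⁻¹-≉0 {a} a≉0 = *-≉0⇒≉0ʳ (≉0-resp-≈ (sym (inverseʳ a a≉0)) 1≉0)

  ⁻¹-involutive : ∀ {a} → a ≉ 0# → a ⁻¹ ⁻¹ ≈ a
  ⁻¹-involutive {a} a≉0 = ⁻¹-unique (⁻¹-≉0 a≉0) (inverseˡ a a≉0)

  ⁻¹-distrib-* : ∀ {a b} → a ≉ 0# → b ≉ 0# → (a * b) ⁻¹ ≈ a ⁻¹ * b ⁻¹
  ⁻¹-distrib-* {a} {b} a≉0 b≉0 = ⁻¹-unique (*-≉0 a≉0 b≉0) (begin
    (a * b) * (a ⁻¹ * b ⁻¹)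
      ≈⟨ solve 4 (λ a b a' b' → (a :* b) :* (a' :* b') := (a :* a') :* (b :* b')) refl a b (a ⁻¹) (b ⁻¹) ⟩
    (a * a ⁻¹) * (b * b ⁻¹)  ≈⟨ *-cong (inverseʳ a a≉0) (inverseʳ b b≉0) ⟩
    1# * 1#                  ≈⟨ *-identityˡ 1# ⟩
    1#                       ∎)

  /-/ : ∀ a {b d} → b ≉ 0# → d ≉ 0# → a / (b / d) ≈ a / b * d
  /-/ a {b} {d} b≉0 d≉0 = begin
    a * (b * d ⁻¹) ⁻¹        ≈⟨ *-congˡ (⁻¹-distrib-* b≉0 (⁻¹-≉0 d≉0)) ⟩
    a * (b ⁻¹ * d ⁻¹ ⁻¹)     ≈⟨ *-congˡ (*-congˡ (⁻¹-involutive d≉0)) ⟩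
    a * (b ⁻¹ * d)           ≈⟨ *-assoc _ _ _ ⟨
    a / b * d                ∎

  1⁻¹≈1 : 1# ⁻¹ ≈ 1#
  1⁻¹≈1 = ⁻¹-unique 1≉0 (*-identityˡ 1#)

  pow-cong : ∀ {a b} n → a ≈ b → pow a n ≈ pow b n
  pow-cong zero    a≈b = refl
  pow-cong (suc n) a≈b = *-cong a≈b (pow-cong n a≈b)

  pow-+ : ∀ a m n → pow a (m ℕ.+ n) ≈ pow a m * pow a n
  pow-+ a zero    n = sym (*-identityˡ _)
  pow-+ a (suc m) n = trans (*-congˡ (pow-+ a m n)) (sym (*-assoc _ _ _))

  pow-+-∸ : ∀ a {i n} → i ≤ n → pow a i * pow a (n ∸ i) ≈ pow a n
  pow-+-∸ a {i} {n} i≤n =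
    trans (sym (pow-+ a i (n ∸ i))) (reflexive (≡.cong (pow a) (ℕₚ.m+[n∸m]≡n i≤n)))

  pow-distrib-* : ∀ a b n → pow (a * b) n ≈ pow a n * pow b n
  pow-distrib-* a b zero    = sym (*-identityˡ _)
  pow-distrib-* a b (suc n) = trans (*-congˡ (pow-distrib-* a b n))
    (solve 4 (λ a b c d → (a :* b) :* (c :* d) := (a :* c) :* (b :* d)) refl a b (pow a n) (pow b n))

  pow-1 : ∀ n → pow 1# n ≈ 1#
  pow-1 zero    = refl
  pow-1 (suc n) = trans (*-identityˡ _) (pow-1 n)

  pow-⁻¹-inverseˡ : ∀ {a} n → a ≉ 0# → pow (a ⁻¹) n * pow a n ≈ 1#
  pow-⁻¹-inverseˡ {a} n a≉0 =
    trans (sym (pow-distrib-* (a ⁻¹) a n)) (trans (pow-cong n (inverseˡ a a≉0)) (pow-1 n))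

  qPoch-cong : ∀ {a b} q k → a ≈ b → qPoch a q k ≈ qPoch b q k
  qPoch-cong q zero    a≈b = refl
  qPoch-cong q (suc k) a≈b = *-cong (qPoch-cong q k a≈b) (+-congˡ (-‿cong (*-congʳ a≈b)))

  qPoch-suc-head : ∀ a q k → qPoch a q (suc k) ≈ (1# - a) * qPoch (a * q) q k
  qPoch-suc-head a q zero = begin
    1# * (1# - a * 1#)  ≈⟨ *-identityˡ _ ⟩
    1# - a * 1#         ≈⟨ +-congˡ (-‿cong (*-identityʳ a)) ⟩
    1# - a              ≈⟨ *-identityʳ _ ⟨
    (1# - a) * 1#       ∎
  qPoch-suc-head a q (suc k) = begin
    qPoch a q (suc k) * (1# - a * (q * pow q k))
      ≈⟨ *-congʳ (qPoch-suc-head a q k) ⟩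
    ((1# - a) * qPoch (a * q) q k) * (1# - a * (q * pow q k))
      ≈⟨ *-assoc _ _ _ ⟩
    (1# - a) * (qPoch (a * q) q k * (1# - a * (q * pow q k)))
      ≈⟨ *-congˡ (*-congˡ (+-congˡ (-‿cong (*-assoc a q (pow q k))))) ⟨
    (1# - a) * qPoch (a * q) q (suc k) ∎

  qPoch-1 : ∀ a q → qPoch a q 1 ≈ 1# - a
  qPoch-1 a q = trans (qPoch-suc-head a q 0) (*-identityʳ _)

  qPoch-+ : ∀ a q k r → qPoch a q (k ℕ.+ r) ≈ qPoch a q k * qPoch (a * pow q k) q r
  qPoch-+ a q k zero = begin
    qPoch a q (k ℕ.+ 0)   ≡⟨ ≡.cong (qPoch a q) (ℕₚ.+-identityʳ k) ⟩
    qPoch a q k           ≈⟨ *-identityʳ _ ⟨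
    qPoch a q k * 1#      ∎
  qPoch-+ a q k (suc r) = begin
    qPoch a q (k ℕ.+ suc r)
      ≡⟨ ≡.cong (qPoch a q) (ℕₚ.+-suc k r) ⟩
    qPoch a q (k ℕ.+ r) * (1# - a * pow q (k ℕ.+ r))
      ≈⟨ *-cong (qPoch-+ a q k r) (+-congˡ (-‿cong (*-congˡ (pow-+ q k r)))) ⟩
    (qPoch a q k * qPoch (a * pow q k) q r) * (1# - a * (pow q k * pow q r))
      ≈⟨ *-assoc _ _ _ ⟩
    qPoch a q k * (qPoch (a * pow q k) q r * (1# - a * (pow q k * pow q r)))
      ≈⟨ *-congˡ (*-congˡ (+-congˡ (-‿cong (*-assoc a (pow q k) (pow q r))))) ⟨
    qPoch a q k * qPoch (a * pow q k) q (suc r) ∎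

  sumTo-cong : ∀ n {f g : ℕ → Carrier} → (∀ k → k ≤ n → f k ≈ g k) → sumTo n f ≈ sumTo n g
  sumTo-cong zero    f≈g = f≈g 0 z≤n
  sumTo-cong (suc n) f≈g =
    +-cong (sumTo-cong n (λ k k≤n → f≈g k (ℕₚ.m≤n⇒m≤1+n k≤n))) (f≈g (suc n) ℕₚ.≤-refl)

  sumTo-+ : ∀ n (f g : ℕ → Carrier) → sumTo n (λ k → f k + g k) ≈ sumTo n f + sumTo n g
  sumTo-+ zero    f g = refl
  sumTo-+ (suc n) f g = trans (+-congʳ (sumTo-+ n f g))
    (solve 4 (λ a b c d → (a :+ b) :+ (c :+ d) := (a :+ c) :+ (b :+ d)) refl _ _ _ _)

  sumTo-*ˡ : ∀ n a (f : ℕ → Carrier) → sumTo n (λ k → a * f k) ≈ a * sumTo n f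
  sumTo-*ˡ zero    a f = refl
  sumTo-*ˡ (suc n) a f = trans (+-congʳ (sumTo-*ˡ n a f)) (sym (distribˡ _ _ _))

  sumTo-linear : ∀ n a b (f g : ℕ → Carrier) →
                 sumTo n (λ k → a * f k - b * g k) ≈ a * sumTo n f - b * sumTo n g
  sumTo-linear zero    a b f g = refl
  sumTo-linear (suc n) a b f g = trans (+-congʳ (sumTo-linear n a b f g))
    (solve 6 (λ a b S T u v → (a :* S :- b :* T) :+ (a :* u :- b :* v) := a :* (S :+ u) :- b :* (T :+ v))
      refl a b (sumTo n f) (sumTo n g) (f (suc n)) (g (suc n)))

  sumTo-suc-head : ∀ n (f : ℕ → Carrier) → sumTo (suc n) f ≈ f 0 + sumTo n (λ k → f (suc k))
  sumTo-suc-head zero    f = refl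
  sumTo-suc-head (suc n) f = trans (+-congʳ (sumTo-suc-head n f)) (+-assoc _ _ _)

module _ {c ℓ} (F : Field c ℓ) where
  open FieldOps F
  open FieldProperties F
  open IntegerCoefficientSolver commutativeRing
  open import Algebra.Properties.Group +-group using () renaming (x≈y⇒x∙y⁻¹≈ε to x≈y⇒x-y≈0)
  open import Relation.Binary.Reasoning.Setoid setoid

  module ClearedSeries (q : Carrier) (q≉0 : q ≉ 0#) (qPoch-q≉0 : ∀ k → qPoch q q k ≉ 0#) where
    -- Ψ n x y z = (y;q)ₙ · ₂Φ₁[q⁻ⁿ, x; y; q; z], with each (y;q)ₙ/(y;q)ₖ cleared to (yqᵏ;q)ₙ₋ₖ.
    ψ : ℕ → Carrier → Carrier → ℕ → Carrier
    ψ n x y k = qPoch (pow (q ⁻¹) n) q k * qPoch x q k * qPoch (y * pow q k) q (n ∸ k) * qPoch q q k ⁻¹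

    Ψ : ℕ → Carrier → Carrier → Carrier → Carrier
    Ψ n x y z = sumTo n (λ k → ψ n x y k * pow z k)

    phi21term≈Ψ : ∀ n x y z → (∀ k → k ≤ n → qPoch y q k ≉ 0#) →
      phi21term n x y q z ≈ qPoch y q n ⁻¹ * Ψ n x y z
    phi21term≈Ψ n x y z yPoch≉0 = trans (sumTo-cong n term) (sumTo-*ˡ n (qPoch y q n ⁻¹) _)
      where
      term : ∀ k → k ≤ n → qPoch (pow (q ⁻¹) n) q k * qPoch x q k / (qPoch y q k * qPoch q q k) * pow z k
                           ≈ qPoch y q n ⁻¹ * (ψ n x y k * pow z k)
      term k k≤n = begin
        W * X * (Y * Q) ⁻¹ * pow z k
          ≈⟨ *-congʳ (*-congˡ (trans (⁻¹-distrib-* (yPoch≉0 k k≤n) (qPoch-q≉0 k)) (*-congʳ Y⁻¹≈VYₙ⁻¹))) ⟩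
        W * X * (V * Yₙ ⁻¹ * Q ⁻¹) * pow z k
          ≈⟨ solve 6 (λ W X V Yₙ' Q' Z → W :* X :* (V :* Yₙ' :* Q') :* Z := Yₙ' :* (W :* X :* V :* Q' :* Z))
               refl W X V (Yₙ ⁻¹) (Q ⁻¹) (pow z k) ⟩
        Yₙ ⁻¹ * (ψ n x y k * pow z k) ∎
        where
        W = qPoch (pow (q ⁻¹) n) q k
        X = qPoch x q k
        Y = qPoch y q k
        Q = qPoch q q k
        V = qPoch (y * pow q k) q (n ∸ k)
        Yₙ = qPoch y q n
        Yₙ≈YV : Yₙ ≈ Y * V
        Yₙ≈YV = trans (reflexive (≡.cong (qPoch y q) (≡.sym (ℕₚ.m+[n∸m]≡n k≤n)))) (qPoch-+ y q k (n ∸ k))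
        Y⁻¹≈VYₙ⁻¹ : Y ⁻¹ ≈ V * Yₙ ⁻¹
        Y⁻¹≈VYₙ⁻¹ = ⁻¹-unique (yPoch≉0 k k≤n)
          (trans (sym (*-assoc _ _ _)) (trans (*-congʳ (sym Yₙ≈YV)) (inverseʳ Yₙ (yPoch≉0 n ℕₚ.≤-refl))))

    1-q⁻¹ⁿqⁿ≈0 : ∀ n → 1# - pow (q ⁻¹) n * pow q n ≈ 0#
    1-q⁻¹ⁿqⁿ≈0 n = x≈y⇒x-y≈0 (sym (pow-⁻¹-inverseˡ n q≉0))

    1-q¹⁺ⁱ≉0 : ∀ i → 1# - q * pow q i ≉ 0#
    1-q¹⁺ⁱ≉0 i = *-≉0⇒≉0ʳ (qPoch-q≉0 (suc i))

    ψ-vanish : ∀ n x y → ψ n x y (suc n) ≈ 0#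
    ψ-vanish n x y = begin
      qPoch w q n * (1# - w * pow q n) * X * V * I   ≈⟨ *-congʳ (*-congʳ (*-congʳ (*-congˡ (1-q⁻¹ⁿqⁿ≈0 n)))) ⟩
      qPoch w q n * 0# * X * V * I                   ≈⟨ solve 4 (λ W X V I → W :* con 0ℤ :* X :* V :* I := con 0ℤ)
                                                          refl (qPoch w q n) X V I ⟩
      0#                                             ∎
      where
      w = pow (q ⁻¹) n
      X = qPoch x q (suc n)
      V = qPoch (y * pow q (suc n)) q (n ∸ suc n)
      I = qPoch q q (suc n) ⁻¹

    ψ-suc-zero : ∀ n x y → ψ (suc n) x y 0 ≈ (1# - y * pow q n) * ψ n x y 0
    ψ-suc-zero n x y = trans
      (solve 4 (λ Y y' p i → con 1ℤ :* con 1ℤ :* (Y :* (con 1ℤ :- y' :* p)) :* i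
                         := (con 1ℤ :- y' :* p) :* (con 1ℤ :* con 1ℤ :* Y :* i))
        refl (qPoch (y * 1#) q n) (y * 1#) (pow q n) (1# ⁻¹))
      (*-congʳ (+-congˡ (-‿cong (*-congʳ (*-identityʳ y)))))

    ψ-suc-suc : ∀ n x y i →
      ψ (suc n) x y (suc i)
        ≈ (1# - x) * ψ n (x * q) (y * q) i * ((1# - pow (q ⁻¹) (suc n)) * (1# - q * pow q i) ⁻¹)
    ψ-suc-suc n x y i = begin
      qPoch (q ⁻¹ * w) q (suc i) * qPoch x q (suc i) * qPoch (y * (q * pow q i)) q (n ∸ i) * qPoch q q (suc i) ⁻¹
        ≈⟨ *-cong (*-cong (*-cong (trans (qPoch-suc-head (q ⁻¹ * w) q i) (*-congˡ (qPoch-cong q i q⁻¹wq≈w)))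
                                    (qPoch-suc-head x q i))
                           (qPoch-cong q (n ∸ i) (sym (*-assoc y q (pow q i)))))
                  (⁻¹-distrib-* (*-≉0⇒≉0ˡ (qPoch-q≉0 (suc i))) (1-q¹⁺ⁱ≉0 i)) ⟩
      ((1# - q ⁻¹ * w) * W) * ((1# - x) * X) * V * (I * r)
        ≈⟨ solve 7 (λ b W x X V I r → ((con 1ℤ :- b) :* W) :* ((con 1ℤ :- x) :* X) :* V :* (I :* r)
                    := (con 1ℤ :- x) :* (W :* X :* V :* I) :* ((con 1ℤ :- b) :* r))
             refl (q ⁻¹ * w) W x X V I r ⟩
      (1# - x) * ψ n (x * q) (y * q) i * ((1# - q ⁻¹ * w) * r) ∎
      where
      w = pow (q ⁻¹) n
      W = qPoch w q i
      X = qPoch (x * q) q i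
      V = qPoch (y * q * pow q i) q (n ∸ i)
      I = qPoch q q i ⁻¹
      r = (1# - q * pow q i) ⁻¹
      q⁻¹wq≈w : q ⁻¹ * w * q ≈ w
      q⁻¹wq≈w = trans (solve 3 (λ a b c → a :* b :* c := a :* c :* b) refl (q ⁻¹) w q)
                      (trans (*-congʳ (inverseˡ q q≉0)) (*-identityˡ w))

    ψ-index-suc : ∀ n x y i → i ≤ n →
      (1# - y * pow q n) * ψ n x y (suc i)
        ≈ (1# - x) * ψ n (x * q) (y * q) i * ((1# - pow (q ⁻¹) n * pow q i) * (1# - q * pow q i) ⁻¹)
    ψ-index-suc n x y i i≤n with ℕₚ.m≤n⇒m<n∨m≡n i≤n
    ... | inj₂ ≡.refl = begin
      (1# - y * pow q n) * ψ n x y (suc n)   ≈⟨ *-congˡ (ψ-vanish n x y) ⟩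
      (1# - y * pow q n) * 0#                ≈⟨ zeroʳ _ ⟩
      0#                                     ≈⟨ zeroʳ _ ⟨
      (1# - x) * ψ n (x * q) (y * q) n * 0#  ≈⟨ *-congˡ (trans (*-congʳ (1-q⁻¹ⁿqⁿ≈0 n)) (zeroˡ _)) ⟨
      (1# - x) * ψ n (x * q) (y * q) n * ((1# - pow (q ⁻¹) n * pow q n) * (1# - q * pow q n) ⁻¹) ∎
    ... | inj₁ i<n = begin
      (1# - y * pow q n) * ((W * (1# - w * p)) * qPoch x q (suc i) * qPoch (y * (q * p)) q (n ∸ suc i) * qPoch q q (suc i) ⁻¹)
        ≈⟨ *-congˡ (*-cong (*-cong (*-congˡ (qPoch-suc-head x q i)) (qPoch-cong q (n ∸ suc i) (sym (*-assoc y q p))))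
                           (⁻¹-distrib-* (*-≉0⇒≉0ˡ (qPoch-q≉0 (suc i))) (1-q¹⁺ⁱ≉0 i))) ⟩
      (1# - y * pow q n) * ((W * (1# - w * p)) * ((1# - x) * X) * U * (I * r))
        ≈⟨ solve 8 (λ W u x X U I r v → v :* ((W :* u) :* ((con 1ℤ :- x) :* X) :* U :* (I :* r))
                    := (con 1ℤ :- x) :* (W :* X :* (U :* v) :* I) :* (u :* r))
             refl W (1# - w * p) x X U I r (1# - y * pow q n) ⟩
      (1# - x) * (W * X * (U * (1# - y * pow q n)) * I) * ((1# - w * p) * r)
        ≈⟨ *-congʳ (*-congˡ (*-congʳ (*-congˡ (sym V≈U[1-yqⁿ])))) ⟩
      (1# - x) * ψ n (x * q) (y * q) i * ((1# - w * p) * r) ∎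
      where
      w = pow (q ⁻¹) n
      p = pow q i
      W = qPoch w q i
      X = qPoch (x * q) q i
      a = y * q * p
      U = qPoch a q (n ∸ suc i)
      I = qPoch q q i ⁻¹
      r = (1# - q * p) ⁻¹
      V≈U[1-yqⁿ] : qPoch a q (n ∸ i) ≈ U * (1# - y * pow q n)
      V≈U[1-yqⁿ] = begin
        qPoch a q (n ∸ i)          ≡⟨ ≡.cong (qPoch a q) (ℕₚ.+-∸-assoc 1 i<n) ⟩
        U * (1# - a * pow q (n ∸ suc i))
          ≈⟨ *-congˡ (+-congˡ (-‿cong (trans (trans (*-congʳ (*-assoc y q p)) (*-assoc _ _ _))
                                              (*-congˡ (pow-+-∸ q i<n))))) ⟩
        U * (1# - y * pow q n)     ∎

    ψ-suc : ∀ n x y i → i ≤ n →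
      ψ (suc n) x y (suc i)
        ≈ (1# - y * pow q n) * ψ n x y (suc i) - pow (q ⁻¹) (suc n) * ((1# - x) * ψ n (x * q) (y * q) i)
    ψ-suc n x y i i≤n = begin
      ψ (suc n) x y (suc i)                 ≈⟨ ψ-suc-suc n x y i ⟩
      A * ((1# - b) * r)                    ≈⟨ *-congˡ [1-b]r≈[1-wp]r-b ⟩
      A * ((1# - w * p) * r - b)            ≈⟨ solve 3 (λ A u b → A :* (u :- b) := A :* u :- b :* A) refl A ((1# - w * p) * r) b ⟩
      A * ((1# - w * p) * r) - b * A        ≈⟨ +-congʳ (ψ-index-suc n x y i i≤n) ⟨
      (1# - y * pow q n) * ψ n x y (suc i) - b * A ∎
      where
      w = pow (q ⁻¹) n
      b = q ⁻¹ * w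
      p = pow q i
      r = (1# - q * p) ⁻¹
      A = (1# - x) * ψ n (x * q) (y * q) i
      qb≈w : q * b ≈ w
      qb≈w = trans (sym (*-assoc q (q ⁻¹) w)) (trans (*-congʳ (inverseʳ q q≉0)) (*-identityˡ w))
      [1-b]r≈[1-wp]r-b : (1# - b) * r ≈ (1# - w * p) * r - b
      [1-b]r≈[1-wp]r-b = sym (begin
        (1# - w * p) * r - b                       ≈⟨ +-congˡ (-‿cong (*-identityʳ b)) ⟨
        (1# - w * p) * r - b * 1#                  ≈⟨ +-congˡ (-‿cong (*-congˡ (inverseʳ _ (1-q¹⁺ⁱ≉0 i)))) ⟨
        (1# - w * p) * r - b * ((1# - q * p) * r)
          ≈⟨ solve 5 (λ w p r b q → (con 1ℤ :- w :* p) :* r :- b :* ((con 1ℤ :- q :* p) :* r)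
                      := (con 1ℤ :- b) :* r :+ (q :* b :* p :- w :* p) :* r) refl w p r b q ⟩
        (1# - b) * r + (q * b * p - w * p) * r      ≈⟨ +-congˡ (*-congʳ (+-congʳ (*-congʳ qb≈w))) ⟩
        (1# - b) * r + (w * p - w * p) * r          ≈⟨ +-congˡ (trans (*-congʳ (-‿inverseʳ _)) (zeroˡ r)) ⟩
        (1# - b) * r + 0#                          ≈⟨ +-identityʳ _ ⟩
        (1# - b) * r                               ∎)

    Ψ-suc : ∀ n x y z →
      Ψ (suc n) x y z ≈ (1# - y * pow q n) * Ψ n x y z - (pow (q ⁻¹) (suc n) * z * (1# - x)) * Ψ n (x * q) (y * q) z
    Ψ-suc n x y z = begin
      sumTo (suc n) T                                 ≈⟨ sumTo-suc-head n T ⟩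
      T 0 + sumTo n (λ i → T (suc i))                 ≈⟨ +-cong (*-congʳ (ψ-suc-zero n x y)) (sumTo-cong n T-suc) ⟩
      α * ψ n x y 0 * 1# + sumTo n (λ i → α * G (suc i) - β * H i)
        ≈⟨ +-cong (*-assoc α _ 1#) (sumTo-linear n α β (λ i → G (suc i)) H) ⟩
      α * G 0 + (α * sumTo n (λ i → G (suc i)) - β * Ψ n (x * q) (y * q) z)
        ≈⟨ solve 5 (λ a g S b H → a :* g :+ (a :* S :- b :* H) := a :* (g :+ S) :- b :* H)
             refl α (G 0) (sumTo n (λ i → G (suc i))) β (Ψ n (x * q) (y * q) z) ⟩
      α * (G 0 + sumTo n (λ i → G (suc i))) - β * Ψ n (x * q) (y * q) z
        ≈⟨ +-congʳ (*-congˡ (sumTo-suc-head n G)) ⟨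
      α * (Ψ n x y z + G (suc n)) - β * Ψ n (x * q) (y * q) z
        ≈⟨ +-congʳ (*-congˡ (trans (+-congˡ (trans (*-congʳ (ψ-vanish n x y)) (zeroˡ _))) (+-identityʳ _))) ⟩
      α * Ψ n x y z - β * Ψ n (x * q) (y * q) z       ∎
      where
      α = 1# - y * pow q n
      β = pow (q ⁻¹) (suc n) * z * (1# - x)
      T G H : ℕ → Carrier
      T k = ψ (suc n) x y k * pow z k
      G k = ψ n x y k * pow z k
      H k = ψ n (x * q) (y * q) k * pow z k
      T-suc : ∀ i → i ≤ n → T (suc i) ≈ α * G (suc i) - β * H i
      T-suc i i≤n = trans (*-congʳ (ψ-suc n x y i i≤n))
        (solve 7 (λ a g b x h z zi → (a :* g :- b :* ((con 1ℤ :- x) :* h)) :* (z :* zi)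
                                 := a :* (g :* (z :* zi)) :- b :* z :* (con 1ℤ :- x) :* (h :* zi))
          refl α (ψ n x y (suc i)) (pow (q ⁻¹) (suc n)) x (ψ n (x * q) (y * q) i) z (pow z i))

    q-Chu-Vandermonde : ∀ n x y → x ≉ 0# → Ψ n x y q ≈ pow x n * qPoch (y / x) q n
    q-Chu-Vandermonde zero x y x≉0 = trans (*-congʳ (*-congˡ 1⁻¹≈1))
      (solve 0 (con 1ℤ :* con 1ℤ :* con 1ℤ :* con 1ℤ :* con 1ℤ := con 1ℤ :* con 1ℤ) refl)
    q-Chu-Vandermonde (suc n) x y x≉0 = begin
      Ψ (suc n) x y q
        ≈⟨ Ψ-suc n x y q ⟩
      (1# - y * p) * Ψ n x y q - (q ⁻¹ * w * q * (1# - x)) * Ψ n (x * q) (y * q) q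
        ≈⟨ +-cong (*-congˡ (q-Chu-Vandermonde n x y x≉0))
                  (-‿cong (*-congˡ (q-Chu-Vandermonde n (x * q) (y * q) (*-≉0 x≉0 q≉0)))) ⟩
      (1# - y * p) * (X * P) - (q ⁻¹ * w * q * (1# - x)) * (pow (x * q) n * qPoch (y * q / (x * q)) q n)
        ≈⟨ +-congˡ (-‿cong (*-congˡ (*-cong (pow-distrib-* x q n) (qPoch-cong q n yq/xq≈y/x)))) ⟩
      (1# - y * p) * (X * P) - (q ⁻¹ * w * q * (1# - x)) * (X * p * P)
        ≈⟨ +-congˡ (-‿cong (solve 7 (λ q' w q x X p P → (q' :* w :* q :* (con 1ℤ :- x)) :* (X :* p :* P)
                                          := (q' :* q) :* (w :* p) :* ((con 1ℤ :- x) :* (X :* P)))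
                              refl (q ⁻¹) w q x X p P)) ⟩
      (1# - y * p) * (X * P) - (q ⁻¹ * q) * (w * p) * ((1# - x) * (X * P))
        ≈⟨ +-congˡ (-‿cong (*-congʳ (trans (*-cong (inverseˡ q q≉0) (pow-⁻¹-inverseˡ n q≉0)) (*-identityˡ 1#)))) ⟩
      (1# - y * p) * (X * P) - 1# * ((1# - x) * (X * P))
        ≈⟨ solve 6 (λ x x' y p X P → (con 1ℤ :- y :* p) :* (X :* P) :- con 1ℤ :* ((con 1ℤ :- x) :* (X :* P))
                                  := x :* X :* (P :* (con 1ℤ :- y :* x' :* p)) :+ (x :* x' :- con 1ℤ) :* (y :* p :* X :* P))
             refl x (x ⁻¹) y p X P ⟩
      x * X * (P * (1# - y / x * p)) + (x * x ⁻¹ - 1#) * (y * p * X * P)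
        ≈⟨ +-congˡ (trans (*-congʳ (x≈y⇒x-y≈0 (inverseʳ x x≉0))) (zeroˡ _)) ⟩
      x * X * (P * (1# - y / x * p)) + 0#
        ≈⟨ +-identityʳ _ ⟩
      x * X * (P * (1# - y / x * p)) ∎
      where
      w = pow (q ⁻¹) n
      p = pow q n
      X = pow x n
      P = qPoch (y / x) q n
      yq/xq≈y/x : y * q / (x * q) ≈ y / x
      yq/xq≈y/x = begin
        y * q * (x * q) ⁻¹          ≈⟨ *-congˡ (⁻¹-distrib-* x≉0 q≉0) ⟩
        y * q * (x ⁻¹ * q ⁻¹)       ≈⟨ solve 4 (λ y q x' q' → y :* q :* (x' :* q') := y :* x' :* (q' :* q))
                                            refl y q (x ⁻¹) (q ⁻¹) ⟩
        y * x ⁻¹ * (q ⁻¹ * q)       ≈⟨ *-congˡ (inverseˡ q q≉0) ⟩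
        y * x ⁻¹ * 1#               ≈⟨ *-identityʳ _ ⟩
        y / x                       ∎

    ψ-y/q : ∀ n x y k → k ≤ n →
      (1# - y / q * pow q n) * ψ n x (y / q) k ≈ (1# - y / q * pow q k) * ψ n x y k
    ψ-y/q n x y k k≤n = begin
      (1# - y' * pow q n) * (W * X * qPoch a q (n ∸ k) * I)
        ≈⟨ solve 5 (λ u W X V I → u :* (W :* X :* V :* I) := W :* X :* (V :* u) :* I) refl _ W X _ I ⟩
      W * X * (qPoch a q (n ∸ k) * (1# - y' * pow q n)) * I
        ≈⟨ *-congʳ (*-congˡ (*-congˡ (+-congˡ (-‿cong (trans (*-congˡ (sym (pow-+-∸ q k≤n))) (sym (*-assoc _ _ _))))))) ⟩
      W * X * qPoch a q (suc (n ∸ k)) * I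
        ≈⟨ *-congʳ (*-congˡ (trans (qPoch-suc-head a q (n ∸ k)) (*-congˡ (qPoch-cong q (n ∸ k) aq≈yqᵏ)))) ⟩
      W * X * ((1# - a) * qPoch (y * pow q k) q (n ∸ k)) * I
        ≈⟨ solve 5 (λ u W X V I → W :* X :* (u :* V) :* I := u :* (W :* X :* V :* I)) refl _ W X _ I ⟩
      (1# - a) * ψ n x y k ∎
      where
      y' = y / q
      a = y' * pow q k
      W = qPoch (pow (q ⁻¹) n) q k
      X = qPoch x q k
      I = qPoch q q k ⁻¹
      aq≈yqᵏ : a * q ≈ y * pow q k
      aq≈yqᵏ = trans (solve 4 (λ y q' p q → y :* q' :* p :* q := y :* p :* (q' :* q)) refl y (q ⁻¹) (pow q k) q)
                     (trans (*-congˡ (inverseˡ q q≉0)) (*-identityʳ _))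

    Ψ-q* : ∀ n x y z → y ≉ 0# →
      Ψ n x y (q * z) ≈ (q / y) * Ψ n x y z - ((q / y) * (1# - y / q * pow q n)) * Ψ n x (y / q) z
    Ψ-q* n x y z y≉0 = trans (sumTo-cong n term) (sumTo-linear n (q / y) ((q / y) * (1# - y / q * pow q n)) _ _)
      where
      term : ∀ k → k ≤ n → ψ n x y k * pow (q * z) k
                           ≈ (q / y) * (ψ n x y k * pow z k) - ((q / y) * (1# - y / q * pow q n)) * (ψ n x (y / q) k * pow z k)
      term k k≤n = sym (begin
        (q / y) * (ψ n x y k * pow z k) - ((q / y) * (1# - y / q * pow q n)) * (ψ n x (y / q) k * pow z k)
          ≈⟨ +-congˡ (-‿cong (solve 4 (λ t u ψ' Z → (t :* u) :* (ψ' :* Z) := t :* Z :* (u :* ψ')) refl (q / y) _ _ (pow z k))) ⟩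
        (q / y) * (ψ n x y k * pow z k) - (q / y) * pow z k * ((1# - y / q * pow q n) * ψ n x (y / q) k)
          ≈⟨ +-congˡ (-‿cong (*-congˡ (ψ-y/q n x y k k≤n))) ⟩
        (q / y) * (ψ n x y k * pow z k) - (q / y) * pow z k * ((1# - y / q * pow q k) * ψ n x y k)
          ≈⟨ solve 7 (λ q y' y q' ψ Z p → q :* y' :* (ψ :* Z) :- q :* y' :* Z :* ((con 1ℤ :- y :* q' :* p) :* ψ)
                                     := ψ :* (p :* Z) :* ((q :* q') :* (y :* y')))
               refl q (y ⁻¹) y (q ⁻¹) (ψ n x y k) (pow z k) (pow q k) ⟩
        ψ n x y k * (pow q k * pow z k) * ((q * q ⁻¹) * (y * y ⁻¹))
          ≈⟨ *-congˡ (trans (*-cong (inverseʳ q q≉0) (inverseʳ y y≉0)) (*-identityˡ 1#)) ⟩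
        ψ n x y k * (pow q k * pow z k) * 1#
          ≈⟨ trans (*-identityʳ _) (*-congˡ (sym (pow-distrib-* q z k))) ⟩
        ψ n x y k * pow (q * z) k ∎)

  module GaussianBinomials (q : Carrier) (qPoch-q≉0 : ∀ k → qPoch q q k ≉ 0#) where

    qBinom-zero : ∀ m → qBinom q m 0 ≈ 1#
    qBinom-zero m = trans (*-congˡ (⁻¹-cong (*-identityˡ _))) (inverseʳ _ (qPoch-q≉0 m))

    qBinom-diag : ∀ m → qBinom q m m ≈ 1#
    qBinom-diag m = begin
      qPoch q q m * (qPoch q q m * qPoch q q (m ∸ m)) ⁻¹
        ≈⟨ *-congˡ (⁻¹-cong (trans (*-congˡ (reflexive (≡.cong (qPoch q q) (ℕₚ.n∸n≡0 m)))) (*-identityʳ _))) ⟩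
      qPoch q q m * qPoch q q m ⁻¹
        ≈⟨ inverseʳ _ (qPoch-q≉0 m) ⟩
      1# ∎

    qBinom-pascal : ∀ m i → i < m → qBinom q (suc m) (suc i) ≈ qBinom q m i + pow q (suc i) * qBinom q m (suc i)
    qBinom-pascal m i i<m = begin
      qBinom q (suc m) (suc i)
        ≈⟨ *-cong (*-congˡ (+-congˡ (-‿cong qᵐ⁺¹≈uv)))
                  (trans (⁻¹-cong (*-congˡ Pₘ₋ᵢ≈Pᵣ[1-v])) (⁻¹-distrib-* (qPoch-q≉0 (suc i)) Pᵣ[1-v]≉0)) ⟩
      A * (1# - u * v) * (Pᵢ₊₁ ⁻¹ * (Pᵣ * (1# - v)) ⁻¹)
        ≈⟨ *-congˡ (*-cong (⁻¹-distrib-* Pᵢ≉0 1-u≉0) (⁻¹-distrib-* Pᵣ≉0 1-v≉0)) ⟩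
      A * (1# - u * v) * (Pᵢ ⁻¹ * a * (Pᵣ ⁻¹ * b))
        ≈⟨ solve 7 (λ A u v Pᵢ' a Pᵣ' b → A :* (con 1ℤ :- u :* v) :* (Pᵢ' :* a :* (Pᵣ' :* b))
                    := A :* (Pᵢ' :* (Pᵣ' :* b)) :+ u :* (A :* (Pᵢ' :* a :* Pᵣ'))
                       :+ A :* (Pᵢ' :* (Pᵣ' :* b)) :* (a :* (con 1ℤ :- u) :- con 1ℤ)
                       :+ u :* (A :* (Pᵢ' :* a :* Pᵣ')) :* (b :* (con 1ℤ :- v) :- con 1ℤ))
             refl A u v (Pᵢ ⁻¹) a (Pᵣ ⁻¹) b ⟩
      binom₁ + u * binom₂ + binom₁ * (a * (1# - u) - 1#) + u * binom₂ * (b * (1# - v) - 1#)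
        ≈⟨ +-cong (+-congˡ (*-congˡ (x≈y⇒x-y≈0 (inverseˡ _ 1-u≉0)))) (*-congˡ (x≈y⇒x-y≈0 (inverseˡ _ 1-v≉0))) ⟩
      binom₁ + u * binom₂ + binom₁ * 0# + u * binom₂ * 0#
        ≈⟨ trans (+-cong (trans (+-congˡ (zeroʳ _)) (+-identityʳ _)) (zeroʳ _)) (+-identityʳ _) ⟩
      binom₁ + u * binom₂
        ≈⟨ +-cong (*-congˡ binom-i) (*-congˡ (*-congˡ binom-suc-i)) ⟨
      qBinom q m i + pow q (suc i) * qBinom q m (suc i) ∎
      where
      r = m ∸ suc i
      A = qPoch q q m
      Pᵢ = qPoch q q i
      Pᵢ₊₁ = qPoch q q (suc i)
      Pᵣ = qPoch q q r
      u = q * pow q i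
      v = q * pow q r
      a = (1# - u) ⁻¹
      b = (1# - v) ⁻¹
      binom₁ = A * (Pᵢ ⁻¹ * (Pᵣ ⁻¹ * b))
      binom₂ = A * (Pᵢ ⁻¹ * a * Pᵣ ⁻¹)
      Pₘ₋ᵢ≈Pᵣ[1-v] : qPoch q q (m ∸ i) ≈ Pᵣ * (1# - v)
      Pₘ₋ᵢ≈Pᵣ[1-v] = reflexive (≡.cong (qPoch q q) (ℕₚ.+-∸-assoc 1 i<m))
      Pᵢ≉0 = *-≉0⇒≉0ˡ (qPoch-q≉0 (suc i))
      1-u≉0 = *-≉0⇒≉0ʳ (qPoch-q≉0 (suc i))
      Pᵣ[1-v]≉0 = ≉0-resp-≈ Pₘ₋ᵢ≈Pᵣ[1-v] (qPoch-q≉0 (m ∸ i))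
      Pᵣ≉0 = *-≉0⇒≉0ˡ Pᵣ[1-v]≉0
      1-v≉0 = *-≉0⇒≉0ʳ Pᵣ[1-v]≉0
      binom-i : (Pᵢ * qPoch q q (m ∸ i)) ⁻¹ ≈ Pᵢ ⁻¹ * (Pᵣ ⁻¹ * b)
      binom-i = trans (⁻¹-cong (*-congˡ Pₘ₋ᵢ≈Pᵣ[1-v]))
                      (trans (⁻¹-distrib-* Pᵢ≉0 Pᵣ[1-v]≉0) (*-congˡ (⁻¹-distrib-* Pᵣ≉0 1-v≉0)))
      binom-suc-i : (Pᵢ₊₁ * Pᵣ) ⁻¹ ≈ Pᵢ ⁻¹ * a * Pᵣ ⁻¹
      binom-suc-i = trans (⁻¹-distrib-* (qPoch-q≉0 (suc i)) Pᵣ≉0) (*-congʳ (⁻¹-distrib-* Pᵢ≉0 1-u≉0))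
      qᵐ⁺¹≈uv : q * pow q m ≈ u * v
      qᵐ⁺¹≈uv = begin
        pow q (suc m)             ≡⟨ ≡.cong (λ k → pow q (suc k)) (ℕₚ.m+[n∸m]≡n i<m) ⟨
        pow q (suc (suc i ℕ.+ r)) ≡⟨ ≡.cong (pow q) (ℕₚ.+-suc (suc i) r) ⟨
        pow q (suc i ℕ.+ suc r)   ≈⟨ pow-+ q (suc i) (suc r) ⟩
        u * v                     ∎

    binomialSum : ℕ → (ℕ → Carrier) → Carrier → Carrier
    binomialSum m f t = sumTo m (λ j → qBinom q m j * f (m ∸ j) * pow t j)

    binomialSum-suc : ∀ m f t → binomialSum (suc m) f t ≈ t * binomialSum m f t + binomialSum m (λ i → f (suc i)) (q * t)
    binomialSum-suc zero f t = begin
      qBinom q 1 0 * f 1 * 1# + qBinom q 1 1 * f 0 * (t * 1#)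
        ≈⟨ +-cong (*-congʳ (*-congʳ (qBinom-zero 1))) (*-congʳ (*-congʳ (qBinom-diag 1))) ⟩
      1# * f 1 * 1# + 1# * f 0 * (t * 1#)
        ≈⟨ solve 3 (λ f₁ f₀ t → con 1ℤ :* f₁ :* con 1ℤ :+ con 1ℤ :* f₀ :* (t :* con 1ℤ)
                               := t :* (con 1ℤ :* f₀ :* con 1ℤ) :+ con 1ℤ :* f₁ :* con 1ℤ) refl (f 1) (f 0) t ⟩
      t * (1# * f 0 * 1#) + 1# * f 1 * 1#
        ≈⟨ +-cong (*-congˡ (*-congʳ (*-congʳ (qBinom-zero 0)))) (*-congʳ (*-congʳ (qBinom-zero 0))) ⟨
      t * (qBinom q 0 0 * f 0 * 1#) + qBinom q 0 0 * f 1 * 1# ∎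
    binomialSum-suc (suc m′) f t = begin
      sumTo (suc m) T
        ≈⟨ sumTo-suc-head m T ⟩
      T 0 + (sumTo m′ (λ i → T (suc i)) + T (suc m))
        ≈⟨ +-cong T₀≈B₀ (+-cong (trans (sumTo-cong m′ T-suc) (trans (sumTo-+ m′ (λ i → t * A i) (λ i → B (suc i)))
                                                                      (+-congʳ (sumTo-*ˡ m′ t A))))
                                Tₘ₊₁≈tAₘ) ⟩
      B 0 + ((t * sumTo m′ A + sumTo m′ (λ i → B (suc i))) + t * A m)
        ≈⟨ solve 5 (λ a t S S' b → a :+ ((t :* S :+ S') :+ t :* b) := t :* (S :+ b) :+ (a :+ S'))
             refl (B 0) t (sumTo m′ A) (sumTo m′ (λ i → B (suc i))) (A m) ⟩
      t * (sumTo m′ A + A m) + (B 0 + sumTo m′ (λ i → B (suc i)))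
        ≈⟨ +-congˡ (sumTo-suc-head m′ B) ⟨
      t * binomialSum m f t + binomialSum m (λ i → f (suc i)) (q * t) ∎
      where
      m = suc m′
      T A B : ℕ → Carrier
      T j = qBinom q (suc m) j * f (suc m ∸ j) * pow t j
      A j = qBinom q m j * f (m ∸ j) * pow t j
      B j = qBinom q m j * f (suc (m ∸ j)) * pow (q * t) j
      T₀≈B₀ : T 0 ≈ B 0
      T₀≈B₀ = *-congʳ (*-congʳ (trans (qBinom-zero (suc m)) (sym (qBinom-zero m))))
      Tₘ₊₁≈tAₘ : T (suc m) ≈ t * A m
      Tₘ₊₁≈tAₘ = trans (*-congʳ (*-congʳ (trans (qBinom-diag (suc m)) (sym (qBinom-diag m)))))
        (solve 4 (λ a f t p → a :* f :* (t :* p) := t :* (a :* f :* p)) refl (qBinom q m m) (f (m ∸ m)) t (pow t m))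
      T-suc : ∀ i → i ≤ m′ → T (suc i) ≈ t * A i + B (suc i)
      T-suc i i≤m′ = begin
        qBinom q (suc m) (suc i) * f (m ∸ i) * (t * pow t i)
          ≈⟨ *-congʳ (*-cong (qBinom-pascal m i (s≤s i≤m′)) (reflexive (≡.cong f m∸i≡1+m∸[1+i]))) ⟩
        (qBinom q m i + pow q (suc i) * qBinom q m (suc i)) * f (suc (m ∸ suc i)) * (t * pow t i)
          ≈⟨ solve 6 (λ a p b f t tⁱ → (a :+ p :* b) :* f :* (t :* tⁱ) := t :* (a :* f :* tⁱ) :+ b :* f :* (p :* (t :* tⁱ)))
               refl (qBinom q m i) (pow q (suc i)) (qBinom q m (suc i)) (f (suc (m ∸ suc i))) t (pow t i) ⟩
        t * (qBinom q m i * f (suc (m ∸ suc i)) * pow t i) + qBinom q m (suc i) * f (suc (m ∸ suc i)) * (pow q (suc i) * pow t (suc i))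
          ≈⟨ +-cong (*-congˡ (*-congʳ (*-congˡ (reflexive (≡.cong f (≡.sym m∸i≡1+m∸[1+i]))))))
                    (*-congˡ (sym (pow-distrib-* q t (suc i)))) ⟩
        t * A i + B (suc i) ∎
        where
        m∸i≡1+m∸[1+i] : m ∸ i ≡ suc (m ∸ suc i)
        m∸i≡1+m∸[1+i] = ℕₚ.+-∸-assoc 1 (s≤s i≤m′)

  module RightHandSide (q : Carrier) (q≉0 : q ≉ 0#) (qPoch-q≉0 : ∀ k → qPoch q q k ≉ 0#)
                       (n : ℕ) (x : Carrier) (x≉0 : x ≉ 0#) where
    open ClearedSeries q q≉0 qPoch-q≉0
    open GaussianBinomials q qPoch-q≉0

    w : Carrier
    w = pow (q ⁻¹) n

    α β γ K : Carrier → Carrier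
    α y = q * w / y
    β y = q * x / y
    γ y = x * (q * w) / y
    K y = (1# - α y) * (1# - β y) / (1# - γ y)

    weight : Carrier → ℕ → Carrier
    weight y i = qPoch (α y) q i * qPoch (β y) q i / qPoch (γ y) q i

    prefactor : Carrier → Carrier
    prefactor y = pow x n * qPoch (y / x) q n

    -- (y;q)ₙ times the right-hand side of the theorem
    rhs : ℕ → Carrier → Carrier
    rhs m y = prefactor y * binomialSum m (weight y) (q / y)

    weight-suc : ∀ y i → y ≉ 0# → qPoch (γ y) q (suc i) ≉ 0# → weight y (suc i) ≈ K y * weight (y / q) i
    weight-suc y i y≉0 γ≉0 = begin
      qPoch (α y) q (suc i) * qPoch (β y) q (suc i) * qPoch (γ y) q (suc i) ⁻¹
        ≈⟨ *-cong (*-cong (head (q * w)) (head (q * x)))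
                  (trans (⁻¹-cong (head (x * (q * w)))) (⁻¹-distrib-* (*-≉0⇒≉0ˡ γ≉0′) (*-≉0⇒≉0ʳ γ≉0′))) ⟩
      ((1# - α y) * A) * ((1# - β y) * B) * ((1# - γ y) ⁻¹ * C ⁻¹)
        ≈⟨ solve 6 (λ a A b B g C → ((con 1ℤ :- a) :* A) :* ((con 1ℤ :- b) :* B) :* (g :* C)
                    := ((con 1ℤ :- a) :* (con 1ℤ :- b) :* g) :* (A :* B :* C))
             refl (α y) A (β y) B ((1# - γ y) ⁻¹) (C ⁻¹) ⟩
      K y * weight (y / q) i ∎
      where
      A = qPoch (α (y / q)) q i
      B = qPoch (β (y / q)) q i
      C = qPoch (γ (y / q)) q i
      head : ∀ a → qPoch (a / y) q (suc i) ≈ (1# - a / y) * qPoch (a / (y / q)) q i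
      head a = trans (qPoch-suc-head (a / y) q i) (*-congˡ (qPoch-cong q i (sym (/-/ a y≉0 q≉0))))
      γ≉0′ : (1# - γ y) * C ≉ 0#
      γ≉0′ = ≉0-resp-≈ (head (x * (q * w))) γ≉0

    -- Both are polynomial identities modulo x x⁻¹ = y y⁻¹ = q q⁻¹ = q⁻ⁿ qⁿ = 1: the solver
    -- checks them with explicit multiples of (product − 1), which are then cancelled.

    1-β≈-β[1-y/q/x] : ∀ y → y ≉ 0# → 1# - β y ≈ - (β y * (1# - y / q / x))
    1-β≈-β[1-y/q/x] y y≉0 = sym (begin
      - (β y * (1# - y / q / x))
        ≈⟨ solve 6 (λ q q' x x' y y' → :- (q :* x :* y' :* (con 1ℤ :- y :* q' :* x'))
                    := con 1ℤ :- q :* x :* y' :+ (q :* q' :* (x :* x') :* (y :* y') :- con 1ℤ))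
             refl q (q ⁻¹) x (x ⁻¹) y (y ⁻¹) ⟩
      1# - β y + (q * q ⁻¹ * (x * x ⁻¹) * (y * y ⁻¹) - 1#)
        ≈⟨ +-congˡ (x≈y⇒x-y≈0 (trans (*-cong (*-cong (inverseʳ q q≉0) (inverseʳ x x≉0)) (inverseʳ y y≉0))
                                    (trans (*-identityʳ _) (*-identityʳ 1#)))) ⟩
      1# - β y + 0#
        ≈⟨ +-identityʳ _ ⟩
      1# - β y ∎)

    x[1-α][1-y/q/x·qⁿ]≈[1-y/q·qⁿ][1-γ] : ∀ y → y ≉ 0# →
      x * (1# - α y) * (1# - y / q / x * pow q n) ≈ (1# - y / q * pow q n) * (1# - γ y)
    x[1-α][1-y/q/x·qⁿ]≈[1-y/q·qⁿ][1-γ] y y≉0 = begin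
      x * (1# - α y) * (1# - y / q / x * p)
        ≈⟨ solve 8 (λ x x' q q' y y' w p → x :* (con 1ℤ :- q :* w :* y') :* (con 1ℤ :- y :* q' :* x' :* p)
                    := (con 1ℤ :- y :* q' :* p) :* (con 1ℤ :- x :* (q :* w) :* y')
                       :+ (x :* x' :- con 1ℤ) :* (q :* q' :* (y :* y') :* (w :* p) :- y :* q' :* p)
                       :+ (q :* q' :* (y :* y') :* (w :* p) :- con 1ℤ) :* (con 1ℤ :- x))
             refl x (x ⁻¹) q (q ⁻¹) y (y ⁻¹) w p ⟩
      (1# - y / q * p) * (1# - γ y) + (x * x ⁻¹ - 1#) * (N - y / q * p) + (N - 1#) * (1# - x)
        ≈⟨ +-cong (+-congˡ (*-congʳ (x≈y⇒x-y≈0 (inverseʳ x x≉0)))) (*-congʳ (x≈y⇒x-y≈0 N≈1)) ⟩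
      (1# - y / q * p) * (1# - γ y) + 0# * (N - y / q * p) + 0# * (1# - x)
        ≈⟨ trans (+-cong (trans (+-congˡ (zeroˡ _)) (+-identityʳ _)) (zeroˡ _)) (+-identityʳ _) ⟩
      (1# - y / q * p) * (1# - γ y) ∎
      where
      p = pow q n
      N = q * q ⁻¹ * (y * y ⁻¹) * (w * p)
      N≈1 : N ≈ 1#
      N≈1 = trans (*-cong (*-cong (inverseʳ q q≉0) (inverseʳ y y≉0)) (pow-⁻¹-inverseˡ n q≉0))
                  (trans (*-identityʳ _) (*-identityʳ 1#))

    prefactor-K : ∀ y → y ≉ 0# → 1# - γ y ≉ 0# →
      prefactor y * K y ≈ - (q / y * (1# - y / q * pow q n) * prefactor (y / q))
    prefactor-K y y≉0 1-γ≉0 = begin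
      X * P * ((1# - α y) * (1# - β y) * g)
        ≈⟨ *-congˡ (*-congʳ (*-congˡ (1-β≈-β[1-y/q/x] y y≉0))) ⟩
      X * P * ((1# - α y) * - (β y * (1# - a)) * g)
        ≈⟨ solve 8 (λ X P α q x y' a g → X :* P :* ((con 1ℤ :- α) :* :- (q :* x :* y' :* (con 1ℤ :- a)) :* g)
                    := :- (q :* y' :* (x :* (con 1ℤ :- α)) :* ((con 1ℤ :- a) :* P) :* X :* g))
             refl X P (α y) q x (y ⁻¹) a g ⟩
      - (q / y * (x * (1# - α y)) * ((1# - a) * P) * X * g)
        ≈⟨ -‿cong (*-congʳ (*-congʳ (*-congˡ [1-a]P≈Pₐ[1-aqⁿ]))) ⟩
      - (q / y * (x * (1# - α y)) * (Pₐ * (1# - a * pow q n)) * X * g)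
        ≈⟨ -‿cong (solve 6 (λ t u Pₐ v X g → t :* u :* (Pₐ :* v) :* X :* g := t :* (u :* v) :* (X :* Pₐ) :* g)
                     refl (q / y) (x * (1# - α y)) Pₐ (1# - a * pow q n) X g) ⟩
      - (q / y * (x * (1# - α y) * (1# - a * pow q n)) * (X * Pₐ) * g)
        ≈⟨ -‿cong (*-congʳ (*-congʳ (*-congˡ (x[1-α][1-y/q/x·qⁿ]≈[1-y/q·qⁿ][1-γ] y y≉0)))) ⟩
      - (q / y * ((1# - y / q * pow q n) * (1# - γ y)) * (X * Pₐ) * g)
        ≈⟨ -‿cong (solve 5 (λ t u v X g → t :* (u :* v) :* X :* g := t :* u :* X :* (v :* g))
                     refl (q / y) (1# - y / q * pow q n) (1# - γ y) (X * Pₐ) g) ⟩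
      - (q / y * (1# - y / q * pow q n) * (X * Pₐ) * ((1# - γ y) * g))
        ≈⟨ -‿cong (trans (*-congˡ (inverseʳ _ 1-γ≉0)) (*-identityʳ _)) ⟩
      - (q / y * (1# - y / q * pow q n) * prefactor (y / q)) ∎
      where
      X = pow x n
      P = qPoch (y / x) q n
      a = y / q / x
      Pₐ = qPoch a q n
      g = (1# - γ y) ⁻¹
      aq≈y/x : a * q ≈ y / x
      aq≈y/x = trans (solve 4 (λ y q' x' q → y :* q' :* x' :* q := y :* x' :* (q' :* q)) refl y (q ⁻¹) (x ⁻¹) q)
                     (trans (*-congˡ (inverseˡ q q≉0)) (*-identityʳ _))
      [1-a]P≈Pₐ[1-aqⁿ] : (1# - a) * P ≈ Pₐ * (1# - a * pow q n)
      [1-a]P≈Pₐ[1-aqⁿ] = sym (trans (qPoch-suc-head a q n) (*-congˡ (qPoch-cong q n aq≈y/x)))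

    rhs-suc : ∀ m y → y ≉ 0# → (∀ i → i ≤ suc m → qPoch (γ y) q i ≉ 0#) →
      rhs (suc m) y ≈ q / y * rhs m y - q / y * (1# - y / q * pow q n) * rhs m (y / q)
    rhs-suc m y y≉0 γ≉0 = begin
      prefactor y * binomialSum (suc m) (weight y) (q / y)
        ≈⟨ *-congˡ (binomialSum-suc m (weight y) (q / y)) ⟩
      prefactor y * (q / y * S + binomialSum m (λ i → weight y (suc i)) (q * (q / y)))
        ≈⟨ *-congˡ (+-congˡ (trans (sumTo-cong m shifted) (sumTo-*ˡ m (K y) _))) ⟩
      prefactor y * (q / y * S + K y * S′)
        ≈⟨ solve 5 (λ P t S K S′ → P :* (t :* S :+ K :* S′) := t :* (P :* S) :+ (P :* K) :* S′)
             refl (prefactor y) (q / y) S (K y) S′ ⟩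
      q / y * rhs m y + prefactor y * K y * S′
        ≈⟨ +-congˡ (*-congʳ (prefactor-K y y≉0 (≉0-resp-≈ (qPoch-1 (γ y) q) (γ≉0 1 (s≤s z≤n))))) ⟩
      q / y * rhs m y + - (ρ * prefactor (y / q)) * S′
        ≈⟨ solve 4 (λ a ρ P S′ → a :+ :- (ρ :* P) :* S′ := a :- ρ :* (P :* S′))
             refl (q / y * rhs m y) ρ (prefactor (y / q)) S′ ⟩
      q / y * rhs m y - ρ * rhs m (y / q) ∎
      where
      S = binomialSum m (weight y) (q / y)
      S′ = binomialSum m (weight (y / q)) (q / (y / q))
      ρ = q / y * (1# - y / q * pow q n)
      shifted : ∀ j → j ≤ m →
        qBinom q m j * weight y (suc (m ∸ j)) * pow (q * (q / y)) j
          ≈ K y * (qBinom q m j * weight (y / q) (m ∸ j) * pow (q / (y / q)) j)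
      shifted j j≤m = begin
        qBinom q m j * weight y (suc (m ∸ j)) * pow (q * (q / y)) j
          ≈⟨ *-cong (*-congˡ (weight-suc y (m ∸ j) y≉0 (γ≉0 (suc (m ∸ j)) (s≤s (ℕₚ.m∸n≤m m j)))))
                    (pow-cong j (trans (*-comm q (q / y)) (sym (/-/ q y≉0 q≉0)))) ⟩
        qBinom q m j * (K y * weight (y / q) (m ∸ j)) * pow (q / (y / q)) j
          ≈⟨ solve 4 (λ b K W p → b :* (K :* W) :* p := K :* (b :* W :* p)) refl (qBinom q m j) (K y) _ _ ⟩
        K y * (qBinom q m j * weight (y / q) (m ∸ j) * pow (q / (y / q)) j) ∎

    Ψ-at-q^[1+m] : ∀ m y → y ≉ 0# → (∀ i → i ≤ m → qPoch (γ y) q i ≉ 0#) → Ψ n x y (pow q (suc m)) ≈ rhs m y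
    Ψ-at-q^[1+m] zero y y≉0 γ≉0 = begin
      Ψ n x y (q * 1#)    ≈⟨ sumTo-cong n (λ k _ → *-congˡ (pow-cong k (*-identityʳ q))) ⟩
      Ψ n x y q           ≈⟨ q-Chu-Vandermonde n x y x≉0 ⟩
      prefactor y         ≈⟨ *-identityʳ _ ⟨
      prefactor y * 1#    ≈⟨ *-congˡ binomialSum₀≈1 ⟨
      rhs 0 y             ∎
      where
      binomialSum₀≈1 : binomialSum 0 (weight y) (q / y) ≈ 1#
      binomialSum₀≈1 = trans (*-congʳ (*-cong (qBinom-zero 0) (*-congˡ 1⁻¹≈1)))
        (solve 0 (con 1ℤ :* (con 1ℤ :* con 1ℤ :* con 1ℤ) :* con 1ℤ := con 1ℤ) refl)
    Ψ-at-q^[1+m] (suc m) y y≉0 γ≉0 = begin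
      Ψ n x y (q * pow q (suc m))
        ≈⟨ Ψ-q* n x y (pow q (suc m)) y≉0 ⟩
      q / y * Ψ n x y (pow q (suc m)) - q / y * (1# - y / q * pow q n) * Ψ n x (y / q) (pow q (suc m))
        ≈⟨ +-cong (*-congˡ (Ψ-at-q^[1+m] m y y≉0 (λ i i≤m → γ≉0 i (ℕₚ.m≤n⇒m≤1+n i≤m))))
                  (-‿cong (*-congˡ (Ψ-at-q^[1+m] m (y / q) (*-≉0 y≉0 (⁻¹-≉0 q≉0)) γ[y/q]≉0))) ⟩
      q / y * rhs m y - q / y * (1# - y / q * pow q n) * rhs m (y / q)
        ≈⟨ rhs-suc m y y≉0 γ≉0 ⟨
      rhs (suc m) y ∎
      where
      γ[y/q]≉0 : ∀ i → i ≤ m → qPoch (γ (y / q)) q i ≉ 0#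
      γ[y/q]≉0 i i≤m = ≉0-resp-≈ (qPoch-cong q i (sym (/-/ (x * (q * w)) y≉0 q≉0)))
        (*-≉0⇒≉0ʳ (≉0-resp-≈ (qPoch-suc-head (γ y) q i) (γ≉0 (suc i) (s≤s i≤m))))

theorem5 : ∀ {c ℓ} (F : Field c ℓ) → let open FieldOps F in
    (q x y : Carrier) (n m : ℕ) →
    ¬ (q ≈ 0#) →
    (∀ k → ¬ (qPoch q q k ≈ 0#)) →
    ¬ (x ≈ 0#) →
    ¬ (y ≈ 0#) →
    (∀ k → k ≤ n → ¬ (qPoch y q k ≈ 0#)) →
    (∀ j → j ≤ m → ¬ (qPoch (x * (q * pow (q ⁻¹) n) / y) q (m ∸ j) ≈ 0#)) →
    phi21term n x y q (pow q (suc m))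
      ≈ (pow x n * qPoch (y / x) q n / qPoch y q n)
        * sumTo m (λ j → qBinom q m j
            * (qPoch ((q * pow (q ⁻¹) n) / y) q (m ∸ j) * qPoch (q * x / y) q (m ∸ j))
              / qPoch (x * (q * pow (q ⁻¹) n) / y) q (m ∸ j)
            * pow (q / y) j)
theorem5 F q x y n m q≉0 qPoch-q≉0 x≉0 y≉0 yPoch≉0 γPoch≉0 = begin
  phi21term n x y q (pow q (suc m))
    ≈⟨ phi21term≈Ψ n x y (pow q (suc m)) yPoch≉0 ⟩
  qPoch y q n ⁻¹ * Ψ n x y (pow q (suc m))
    ≈⟨ *-congˡ (Ψ-at-q^[1+m] m y y≉0 γPoch≉0′) ⟩
  qPoch y q n ⁻¹ * (prefactor y * binomialSum m (weight y) (q / y))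
    ≈⟨ solve 3 (λ Y P S → Y :* (P :* S) := P :* Y :* S) refl (qPoch y q n ⁻¹) (prefactor y) _ ⟩
  prefactor y / qPoch y q n * binomialSum m (weight y) (q / y)
    ≈⟨ *-congˡ (sumTo-cong m (λ j _ → *-congʳ (sym (*-assoc _ _ _)))) ⟩
  _ ∎
  where
  open FieldOps F
  open FieldProperties F
  open ClearedSeries F q q≉0 qPoch-q≉0
  open GaussianBinomials F q qPoch-q≉0
  open RightHandSide F q q≉0 qPoch-q≉0 n x x≉0
  open IntegerCoefficientSolver commutativeRing
  open import Relation.Binary.Reasoning.Setoid setoid
  γPoch≉0′ : ∀ i → i ≤ m → qPoch (γ y) q i ≉ 0#
  γPoch≉0′ i i≤m =
    ≉0-resp-≈ (reflexive (≡.cong (qPoch (γ y) q) (ℕₚ.m∸[m∸n]≡n i≤m))) (γPoch≉0 (m ∸ i) (ℕₚ.m∸n≤m m i))
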